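{- Let $G$ be a $\delta$-hyperbolic graph. Let $(x,y)$ be a locally diametrical pair of vertices of $G$, let $[x,y]$ be a geodesic, let $\lambda=\frac{d(x,y)}{2}$, and let $c=[x,y][\lambda]\in A(G)$ be the midpoint of $[x,y]$. Then every vertex $z\in V(G)$ satisfies $d(z,c)\le \lambda+\delta$.
   Context: Each edge of the finite undirected graph $G$ is a unit-length segment. $A(G)$ is the set of points of $G$, and $d$ is the shortest-path distance on $A(G)$. A geodesic $[x,y]$ is a shortest path from $x$ to $y$, and $[x,y][t]$ is its point at distance $t$ from $x$. A geodesic triangle $\Delta(x,y,z)$ is a union of geodesics $[x,y],[y,z],[x,z]$. Set $\pi=\frac12(d(x,y)+d(y,z)+d(x,z))$, $\alpha_x=\pi-d(y,z)$, $\alpha_y=\pi-d(x,z)$ and $\alpha_z=\pi-d(x,y)$. The insize is the maximum over the three corners of $\max_{\theta\in[0,\alpha_x]} d([x,y][\theta],[x,z][\theta])$ and the analogous quantities at $y$ and $z$. $G$ is $\delta$-hyperbolic if all geodesic triangles have insize at most $\delta$, with $\delta$ the least such constant. Vertices $x,y$ are locally diametrical (in $V(G)$) if no vertex $w$ satisfies $d(x,w)>d(x,y)$ or $d(y,w)>d(x,y)$.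
   Formalization: Points of A(G) lie at rational positions along edges, the geodesic parameters θ and the constant δ are rational, so δ is the least rational insize bound over geodesic triangles with such points. -}

module Defs where

open import Level using (0ℓ)
open import Data.Nat as ℕ using (ℕ; zero; suc)
open import Data.Fin using (Fin; toℕ)
open import Data.Integer using (+_)
open import Data.Rational using (ℚ; 0ℚ; 1ℚ; ½; _+_; _-_; _*_; _≤_; _<_; ∣_∣; _/_)
open import Data.Product using (Σ; ∃; ∃-syntax; _×_; _,_)
open import Relation.Binary.PropositionalEquality using (_≡_)
open import Relation.Nullary using (¬_)

record Graph : Set₁ where
  field
    n       : ℕ
    Adj     : Fin n → Fin n → Set
    sym     : ∀ {u v} → Adj u v → Adj v u
    irrefl  : ∀ {u} → ¬ Adj u u

ℕ→ℚ : ℕ → ℚ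
ℕ→ℚ k = + k / 1

module _ (G : Graph) where
  open Graph G

  data Walk : Fin n → Fin n → ℕ → Set where
    here : ∀ {u} → Walk u u 0
    step : ∀ {u w v k} → Adj u w → Walk w v k → Walk u v (suc k)

  Connected : Set
  Connected = ∀ u v → ∃[ k ] Walk u v k

  VDist : Fin n → Fin n → ℕ → Set
  VDist u v k = Walk u v k × (∀ m → Walk u v m → k ℕ.≤ m)

  -- Points of A(G): a vertex, or an interior point of an edge {u,v}
  -- (stored with toℕ u < toℕ v) at distance t ∈ (0,1) from u.
  data Point : Set where
    vtx : Fin n → Point
    mid : (u v : Fin n) → toℕ u ℕ.< toℕ v → Adj u v →
          (t : ℚ) → 0ℚ < t → t < 1ℚ → Point

  -- Anchor p a o : the vertex a is an endpoint of the (closed) edge/vertex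
  -- carrying p, at distance o from p along that edge.
  data Anchor : Point → Fin n → ℚ → Set where
    anc-vtx : ∀ {v} → Anchor (vtx v) v 0ℚ
    anc-l   : ∀ {u v lt a t p q} → Anchor (mid u v lt a t p q) u t
    anc-r   : ∀ {u v lt a t p q} → Anchor (mid u v lt a t p q) v (1ℚ - t)

  -- Cand p q c : c is the length of some path in A(G) from p to q:
  -- either inside a common edge, or leaving p's edge through an endpoint,
  -- following a walk, and entering q's edge through an endpoint.
  data Cand : Point → Point → ℚ → Set where
    via  : ∀ {p q a b oa ob k} → Anchor p a oa → Anchor q b ob → Walk a b k →
           Cand p q (oa + ℕ→ℚ k + ob)
    same : ∀ {u v lt lt' e e' t t' p p' q q'} →
           Cand (mid u v lt e t p q) (mid u v lt' e' t' p' q') ∣ t - t' ∣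

  IsDist : Point → Point → ℚ → Set
  IsDist p q r = Cand p q r × (∀ c → Cand p q c → r ≤ c)

  _≈_ : Point → Point → Set
  p ≈ q = IsDist p q 0ℚ

  -- A geodesic [x,y]: an isometric map γ of [0,L] into A(G) with
  -- γ(0) = x and γ(L) = y (so L = d(x,y)); γ(s) = [x,y][s].
  -- (γ is given on all of ℚ; only its values on [0,L] matter.)
  record Geodesic (x y : Point) : Set where
    field
      len    : ℚ
      len≥0  : 0ℚ ≤ len
      γ      : ℚ → Point
      start  : γ 0ℚ ≈ x
      end    : γ len ≈ y
      isom   : ∀ s t → 0ℚ ≤ s → s ≤ len → 0ℚ ≤ t → t ≤ len →
               IsDist (γ s) (γ t) ∣ s - t ∣

  open Geodesic public

  revAt : ∀ {x y} → Geodesic x y → ℚ → Point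
  revAt g θ = γ g (len g - θ)

  -- Corner condition: two geodesics f,h issuing from the same corner, with
  -- Gromov product α; all d(f[θ],h[θ]) for θ ∈ [0,α] are at most δ.
  CornerBound : (ℚ → Point) → (ℚ → Point) → ℚ → ℚ → Set
  CornerBound f h α δ = ∀ θ r → 0ℚ ≤ θ → θ ≤ α → IsDist (f θ) (h θ) r → r ≤ δ

  InsizeLe : ∀ {x y z} → Geodesic x y → Geodesic y z → Geodesic x z → ℚ → Set
  InsizeLe gxy gyz gxz δ =
      CornerBound (γ gxy) (γ gxz) αx δ
    × CornerBound (revAt gxy) (γ gyz) αy δ
    × CornerBound (revAt gxz) (revAt gyz) αz δ
    where
      dxy = len gxy
      dyz = len gyz
      dxz = len gxz
      π   = ½ * (dxy + dyz + dxz)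
      αx  = π - dyz
      αy  = π - dxz
      αz  = π - dxy

  HypBound : ℚ → Set
  HypBound δ = ∀ x y z (gxy : Geodesic x y) (gyz : Geodesic y z)
                 (gxz : Geodesic x z) → InsizeLe gxy gyz gxz δ

  IsHyperbolicityConstant : ℚ → Set
  IsHyperbolicityConstant δ = HypBound δ × (∀ δ' → HypBound δ' → δ ≤ δ')

  LocallyDiametrical : Fin n → Fin n → Set
  LocallyDiametrical x y =
    ∃[ D ] VDist x y D ×
      (∀ w k → VDist x w k → k ℕ.≤ D) × (∀ w k → VDist y w k → k ℕ.≤ D)

module Submission where

-- Take geodesics [x,z] and [y,z], of lengths X and Y, built from shortest walks. Local
-- diametricity gives X, Y ≤ d(x,y) = 2λ, and the triangle inequality gives 2λ ≤ X + Y.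
-- If Y ≤ X, the Gromov product at x is α_x = λ + (X - Y)/2 ≥ λ, so the insize bound at the
-- corner x gives d(c, [x,z][λ]) ≤ δ, while d([x,z][λ], z) = X - λ ≤ λ. If X ≤ Y, argue at
-- the corner y, where [x,y] read backwards also passes through c at parameter λ.
-- Distances in A(G) are minima over walks, which exist constructively only under double
-- negation; that suffices since the conclusion is a decidable inequality of rationals.

open import Defs
open import Data.Nat using (ℕ)
open import Data.Fin using (Fin)
open import Data.Integer using (+_)
open import Data.Rational using (ℚ; _+_; _≤_; _/_)

open import Level using (0ℓ)
open import Data.Nat as ℕ using (zero; suc)
import Data.Nat.Properties as ℕₚ
open import Data.Fin using (toℕ)
open import Data.Integer as ℤ using (1ℤ)
import Data.Integer.Properties as ℤₚ
open import Data.Rational using (0ℚ; 1ℚ; ½; -_; _-_; _*_; _<_; ∣_∣; toℚᵘ; _≤?_; _<?_)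
open import Data.Fin.Properties using (toℕ-injective)
open import Data.Rational.Properties
import Data.Rational.Unnormalised as ℚᵘ
import Data.Rational.Unnormalised.Properties as ℚᵘₚ
open import Data.Rational.Solver using (module +-*-Solver)
open import Data.Product using (∃; ∃-syntax; _×_; _,_; proj₁; proj₂)
open import Data.Sum using (_⊎_; inj₁; inj₂; [_,_]′)
open import Effect.Monad using (RawMonad)
open import Relation.Binary.PropositionalEquality
open import Relation.Nullary using (¬_; Dec; yes; no)
open import Relation.Nullary.Decidable using (decidable-stable; ¬¬-excluded-middle)
open import Relation.Nullary.Negation using (¬¬-Monad; contradiction)
open import Function using (id)

open +-*-Solver
open RawMonad (¬¬-Monad {0ℓ}) using (_>>=_; _<$>_; pure)

-- Rational arithmetic

ℕ→ℚ-nonneg : ∀ k → 0ℚ ≤ ℕ→ℚ k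
ℕ→ℚ-nonneg k = nonNegative⁻¹ (ℕ→ℚ k) {{normalize-nonNeg k 1}}

ℕ→ℚ-+ : ∀ m n → ℕ→ℚ (m ℕ.+ n) ≡ ℕ→ℚ m + ℕ→ℚ n
ℕ→ℚ-+ m n = toℚᵘ-injective (begin
  toℚᵘ (ℕ→ℚ (m ℕ.+ n))                           ≈⟨ toℚᵘ-fromℚᵘ (ℚᵘ.mkℚᵘ (+ (m ℕ.+ n)) 0) ⟩
  ℚᵘ.mkℚᵘ (+ (m ℕ.+ n)) 0                         ≈⟨ ℚᵘ.*≡* (trans (cong (ℤ._* 1ℤ) (ℤₚ.pos-+ m n)) unit-denominators) ⟩
  ℚᵘ.mkℚᵘ (+ m) 0 ℚᵘ.+ ℚᵘ.mkℚᵘ (+ n) 0            ≈⟨ ℚᵘₚ.+-cong (toℚᵘ-fromℚᵘ (ℚᵘ.mkℚᵘ (+ m) 0)) (toℚᵘ-fromℚᵘ (ℚᵘ.mkℚᵘ (+ n) 0)) ⟨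
  toℚᵘ (ℕ→ℚ m) ℚᵘ.+ toℚᵘ (ℕ→ℚ n)                   ≈⟨ toℚᵘ-homo-+ (ℕ→ℚ m) (ℕ→ℚ n) ⟨
  toℚᵘ (ℕ→ℚ m + ℕ→ℚ n)                            ∎)
  where
  open ℚᵘₚ.≃-Reasoning
  unit-denominators : (+ m ℤ.+ + n) ℤ.* 1ℤ ≡ (+ m ℤ.* 1ℤ ℤ.+ + n ℤ.* 1ℤ) ℤ.* 1ℤ
  unit-denominators = cong (ℤ._* 1ℤ) (sym (cong₂ ℤ._+_ (ℤₚ.*-identityʳ (+ m)) (ℤₚ.*-identityʳ (+ n))))

half+half : ∀ D → + D / 2 + + D / 2 ≡ ℕ→ℚ D
half+half D = toℚᵘ-injective (begin
  toℚᵘ (+ D / 2 + + D / 2)                      ≈⟨ toℚᵘ-homo-+ (+ D / 2) (+ D / 2) ⟩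
  toℚᵘ (+ D / 2) ℚᵘ.+ toℚᵘ (+ D / 2)             ≈⟨ ℚᵘₚ.+-cong half≃ half≃ ⟩
  ℚᵘ.mkℚᵘ (+ D) 1 ℚᵘ.+ ℚᵘ.mkℚᵘ (+ D) 1           ≈⟨ ℚᵘ.*≡* (trans (ℤₚ.*-identityʳ _) (sym (ℤₚ.*-distribˡ-+ (+ D) _ _))) ⟩
  ℚᵘ.mkℚᵘ (+ D) 0                               ≈⟨ toℚᵘ-fromℚᵘ (ℚᵘ.mkℚᵘ (+ D) 0) ⟨
  toℚᵘ (ℕ→ℚ D)                                  ∎)
  where
  open ℚᵘₚ.≃-Reasoning
  half≃ : toℚᵘ (+ D / 2) ℚᵘ.≃ ℚᵘ.mkℚᵘ (+ D) 1
  half≃ = toℚᵘ-fromℚᵘ (ℚᵘ.mkℚᵘ (+ D) 1)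

half-nonneg : ∀ D → 0ℚ ≤ + D / 2
half-nonneg D = nonNegative⁻¹ (+ D / 2) {{normalize-nonNeg D 2}}

ℕ→ℚ-mono-≤ : ∀ {m n} → m ℕ.≤ n → ℕ→ℚ m ≤ ℕ→ℚ n
ℕ→ℚ-mono-≤ {m} {n} m≤n = subst₂ _≤_ (+-identityʳ (ℕ→ℚ m)) m+[n∸m]≡n
  (+-monoʳ-≤ (ℕ→ℚ m) (ℕ→ℚ-nonneg (n ℕ.∸ m)))
  where
  m+[n∸m]≡n : ℕ→ℚ m + ℕ→ℚ (n ℕ.∸ m) ≡ ℕ→ℚ n
  m+[n∸m]≡n = trans (sym (ℕ→ℚ-+ m (n ℕ.∸ m))) (cong ℕ→ℚ (ℕₚ.m+[n∸m]≡n m≤n))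

p≤q⇒0≤q-p : ∀ {p q} → p ≤ q → 0ℚ ≤ q - p
p≤q⇒0≤q-p {p} {q} p≤q = subst (_≤ q - p) (+-inverseʳ p) (+-monoˡ-≤ (- p) p≤q)

0≤q-p⇒p≤q : ∀ {p q} → 0ℚ ≤ q - p → p ≤ q
0≤q-p⇒p≤q {p} {q} 0≤q-p =
  subst₂ _≤_ (+-identityˡ p) (solve 2 (λ p q → (q :- p) :+ p := q) refl p q) (+-monoˡ-≤ p 0≤q-p)

≤-via-gap : ∀ {p q r s} → p ≤ q → q - p ≡ s - r → r ≤ s
≤-via-gap p≤q gap = 0≤q-p⇒p≤q (subst (0ℚ ≤_) gap (p≤q⇒0≤q-p p≤q))

p+p≤q+q⇒p≤q : ∀ {p q} → p + p ≤ q + q → p ≤ q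
p+p≤q+q⇒p≤q {p} {q} 2p≤2q with p ≤? q
... | yes p≤q = p≤q
... | no p≰q = contradiction (<-≤-trans (+-mono-< (≰⇒> p≰q) (≰⇒> p≰q)) 2p≤2q) (<-irrefl refl)

<⇒≱ : ∀ {p q} → p < q → ¬ q ≤ p
<⇒≱ p<q q≤p = <-irrefl refl (<-≤-trans p<q q≤p)

0<1 : 0ℚ < 1ℚ
0<1 = positive⁻¹ 1ℚ

p≤∣p∣ : ∀ p → p ≤ ∣ p ∣
p≤∣p∣ p with ≤-total 0ℚ p
... | inj₁ 0≤p = ≤-reflexive (sym (0≤p⇒∣p∣≡p 0≤p))
... | inj₂ p≤0 = ≤-trans p≤0 (0≤∣p∣ p)

∣p-q∣≡∣q-p∣ : ∀ p q → ∣ p - q ∣ ≡ ∣ q - p ∣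
∣p-q∣≡∣q-p∣ p q = trans (sym (∣-p∣≡∣p∣ (p - q))) (cong ∣_∣ (solve 2 (λ p q → :- (p :- q) := q :- p) refl p q))

p≤q⇒∣p-q∣≡q-p : ∀ {p q} → p ≤ q → ∣ p - q ∣ ≡ q - p
p≤q⇒∣p-q∣≡q-p {p} {q} p≤q = trans (∣p-q∣≡∣q-p∣ p q) (0≤p⇒∣p∣≡p (p≤q⇒0≤q-p p≤q))

q≤p+∣p-q∣ : ∀ p q → q ≤ p + ∣ p - q ∣
q≤p+∣p-q∣ p q = ≤-via-gap (p≤∣p∣ (q - p)) (trans
  (solve 3 (λ p q a → a :- (q :- p) := (p :+ a) :- q) refl p q ∣ q - p ∣)
  (cong (λ a → p + a - q) (∣p-q∣≡∣q-p∣ q p)))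

p+p≤q+r⇒r≤q⇒p≤q : ∀ {p q r} → p + p ≤ q + r → r ≤ q → p ≤ q
p+p≤q+r⇒r≤q⇒p≤q {q = q} 2p≤q+r r≤q = p+p≤q+q⇒p≤q (≤-trans 2p≤q+r (+-monoʳ-≤ q r≤q))

p≤q+q⇒p-q≤q : ∀ {p q} → p ≤ q + q → p - q ≤ q
p≤q+q⇒p-q≤q {p} {q} p≤2q = ≤-via-gap p≤2q (solve 2 (λ p q → (q :+ q) :- p := q :- (p :- q)) refl p q)

h≤½[h+h+a+b]-c : ∀ {a b c} h → c + c ≤ a + b → h ≤ ½ * (h + h + a + b) - c
h≤½[h+h+a+b]-c {a} {b} {c} h 2c≤a+b = p+p≤q+q⇒p≤q (≤-via-gap 2c≤a+b
  (solve 4 (λ a b c h → (a :+ b) :- (c :+ c)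
                        := (con ½ :* (h :+ h :+ a :+ b) :- c) :+ (con ½ :* (h :+ h :+ a :+ b) :- c) :- (h :+ h))
     refl a b c h))

slide-bound : ∀ {o o' s m oc} → o' ≤ o + s → o' + m + oc ≤ s + (o + m + oc)
slide-bound {o} {o'} {s} {m} {oc} o'≤ = begin
  o' + m + oc       ≡⟨ +-assoc o' m oc ⟩
  o' + (m + oc)     ≤⟨ +-monoˡ-≤ (m + oc) o'≤ ⟩
  o + s + (m + oc)  ≡⟨ solve 4 (λ o s m oc → o :+ s :+ (m :+ oc) := s :+ (o :+ m :+ oc)) refl o s m oc ⟩
  s + (o + m + oc)  ∎
  where open ≤-Reasoning

junction-bound : ∀ {oa ob ob' oc} k m {j} → ℕ→ℚ j ≤ ob + ob' →
  oa + ℕ→ℚ (k ℕ.+ (j ℕ.+ m)) + oc ≤ (oa + ℕ→ℚ k + ob) + (ob' + ℕ→ℚ m + oc)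
junction-bound {oa} {ob} {ob'} {oc} k m {j} j≤ = begin
  oa + ℕ→ℚ (k ℕ.+ (j ℕ.+ m)) + oc
    ≡⟨ cong (λ d → oa + d + oc) (trans (ℕ→ℚ-+ k (j ℕ.+ m)) (cong (λ d → ℕ→ℚ k + d) (ℕ→ℚ-+ j m))) ⟩
  oa + (ℕ→ℚ k + (ℕ→ℚ j + ℕ→ℚ m)) + oc
    ≡⟨ solve 5 (λ oa k j m oc → oa :+ (k :+ (j :+ m)) :+ oc := (oa :+ k :+ m :+ oc) :+ j)
         refl oa (ℕ→ℚ k) (ℕ→ℚ j) (ℕ→ℚ m) oc ⟩
  (oa + ℕ→ℚ k + ℕ→ℚ m + oc) + ℕ→ℚ j
    ≤⟨ +-monoʳ-≤ (oa + ℕ→ℚ k + ℕ→ℚ m + oc) j≤ ⟩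
  (oa + ℕ→ℚ k + ℕ→ℚ m + oc) + (ob + ob')
    ≡⟨ solve 5 (λ x m oc ob ob' → (x :+ m :+ oc) :+ (ob :+ ob') := (x :+ ob) :+ (ob' :+ m :+ oc))
         refl (oa + ℕ→ℚ k) (ℕ→ℚ m) oc ob ob' ⟩
  (oa + ℕ→ℚ k + ob) + (ob' + ℕ→ℚ m + oc) ∎
  where open ≤-Reasoning

∣p-r∣≤∣p-q∣+∣q-r∣ : ∀ p q r → ∣ p - r ∣ ≤ ∣ p - q ∣ + ∣ q - r ∣
∣p-r∣≤∣p-q∣+∣q-r∣ p q r = subst (_≤ ∣ p - q ∣ + ∣ q - r ∣)
  (cong ∣_∣ (solve 3 (λ p q r → (p :- q) :+ (q :- r) := p :- r) refl p q r))
  (∣p+q∣≤∣p∣+∣q∣ (p - q) (q - r))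

0+p+0≡p : ∀ p → 0ℚ + p + 0ℚ ≡ p
0+p+0≡p p = trans (+-identityʳ (0ℚ + p)) (+-identityˡ p)

Least : (ℚ → Set) → Set
Least S = ∃[ r ] S r × (∀ c → S c → r ≤ c)

least-⊎ : ∀ {S T : ℚ → Set} → Least S → Least T → Least (λ c → S c ⊎ T c)
least-⊎ (r , s , r≤) (r' , t , r'≤) with r ≤? r'
... | yes r≤r' = r , inj₁ s , λ c → [ r≤ c , (λ t → ≤-trans r≤r' (r'≤ c t)) ]′
... | no r≰r' = r' , inj₂ t , λ c → [ (λ s → ≤-trans (<⇒≤ (≰⇒> r≰r')) (r≤ c s)) , r'≤ c ]′

least-resp : ∀ {S T : ℚ → Set} → (∀ {c} → S c → T c) → (∀ {c} → T c → S c) → Least S → Least T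
least-resp to from (r , s , r≤) = r , to s , λ c t → r≤ c (from t)

Minimal : (ℕ → Set) → Set
Minimal P = ∃[ m ] P m × (∀ k → P k → m ℕ.≤ k)

¬¬-minimal : ∀ {P : ℕ → Set} {n} → P n → ¬ ¬ Minimal P
¬¬-minimal {P} {n} pn ¬min = none-below (suc n) n (ℕₚ.n<1+n n) pn
  where
  none-below : ∀ m k → k ℕ.< m → ¬ P k
  none-below (suc m) k k<1+m pk with ℕₚ.m≤n⇒m<n∨m≡n (ℕ.s≤s⁻¹ k<1+m)
  ... | inj₁ k<m = none-below m k k<m pk
  ... | inj₂ refl = ¬min (k , pk , λ j pj → ℕₚ.≮⇒≥ (λ j<k → none-below k j j<k pj))

-- Paths and distances in A(G)

module PathMetric (G : Graph) where
  open Graph G renaming (sym to Adj-sym)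

  private variable
    a b c : Fin n
    k m : ℕ
    p p' q q' w : Point G
    ℓ ℓ' o : ℚ

  _++ʷ_ : Walk G a b k → Walk G b c m → Walk G a c (k ℕ.+ m)
  here     ++ʷ w' = w'
  step e w ++ʷ w' = step e (w ++ʷ w')

  reverseʷ : Walk G a b k → Walk G b a k
  reverseʷ here = here
  reverseʷ {k = suc k} (step e w) =
    subst (Walk G _ _) (ℕₚ.+-comm k 1) (reverseʷ w ++ʷ step (Adj-sym e) here)

  anchor-nonneg : Anchor G p a o → 0ℚ ≤ o
  anchor-nonneg anc-vtx              = ≤-refl
  anchor-nonneg (anc-l {p = 0<t})    = <⇒≤ 0<t
  anchor-nonneg (anc-r {q = t<1})    = p≤q⇒0≤q-p (<⇒≤ t<1)

  cand-nonneg : Cand G p q ℓ → 0ℚ ≤ ℓ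
  cand-nonneg (via {k = k} pa qb _) =
    +-mono-≤ (+-mono-≤ (anchor-nonneg pa) (ℕ→ℚ-nonneg k)) (anchor-nonneg qb)
  cand-nonneg (same {t = t} {t' = t'}) = 0≤∣p∣ (t - t')

  cand-sym : Cand G p q ℓ → Cand G q p ℓ
  cand-sym (via {oa = oa} {ob = ob} {k = k} pa qb w) =
    subst (Cand G _ _) (solve 3 (λ oa k ob → ob :+ k :+ oa := oa :+ k :+ ob) refl oa (ℕ→ℚ k) ob)
      (via qb pa (reverseʷ w))
  cand-sym (same {t = t} {t' = t'}) = subst (Cand G _ _) (∣p-q∣≡∣q-p∣ t' t) same

  anchor-junction : Anchor G p a o → Anchor G p b ℓ → ∃[ j ] Walk G a b j × ℕ→ℚ j ≤ o + ℓ
  anchor-junction anc-vtx anc-vtx = 0 , here , ≤-refl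
  anchor-junction pa@anc-l anc-l = 0 , here , +-mono-≤ (anchor-nonneg pa) (anchor-nonneg pa)
  anchor-junction pa@anc-r anc-r = 0 , here , +-mono-≤ (anchor-nonneg pa) (anchor-nonneg pa)
  anchor-junction (anc-l {a = e} {t = t}) anc-r =
    1 , step e here , ≤-reflexive (solve 1 (λ t → con 1ℚ := t :+ (con 1ℚ :- t)) refl t)
  anchor-junction (anc-r {a = e} {t = t}) anc-l =
    1 , step (Adj-sym e) here , ≤-reflexive (solve 1 (λ t → con 1ℚ := (con 1ℚ :- t) :+ t) refl t)

  data SameEdge : Point G → Point G → ℚ → Set where
    same-edge : ∀ {u v lt lt' e e' t t' p p' q q'} →
                SameEdge (mid u v lt e t p q) (mid u v lt' e' t' p' q') ∣ t - t' ∣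

  sameEdge-sym : SameEdge p q ℓ → SameEdge q p ℓ
  sameEdge-sym (same-edge {t = t} {t' = t'}) = subst (SameEdge _ _) (∣p-q∣≡∣q-p∣ t' t) same-edge

  sameEdge-unique : SameEdge p q ℓ → SameEdge p q ℓ' → ℓ ≡ ℓ'
  sameEdge-unique same-edge same-edge = refl

  anchor-slide : SameEdge p q ℓ → Anchor G p a o → ∃[ o' ] Anchor G q a o' × o' ≤ o + ℓ
  anchor-slide (same-edge {t = t} {t' = t'}) anc-l = t' , anc-l , q≤p+∣p-q∣ t t'
  anchor-slide (same-edge {t = t} {t' = t'}) anc-r = 1ℚ - t' , anc-r ,
    subst (λ d → 1ℚ - t' ≤ 1ℚ - t + d)
      (trans (cong ∣_∣ (solve 2 (λ t t' → (con 1ℚ :- t) :- (con 1ℚ :- t') := t' :- t) refl t t'))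
             (∣p-q∣≡∣q-p∣ t' t))
      (q≤p+∣p-q∣ (1ℚ - t) (1ℚ - t'))

  PathWithin : Point G → Point G → ℚ → Set
  PathWithin p q ℓ = ∃[ c ] Cand G p q c × c ≤ ℓ

  cand⇒within : Cand G p q ℓ → PathWithin p q ℓ
  cand⇒within C = _ , C , ≤-refl

  within-weaken : PathWithin p q ℓ → ℓ ≤ ℓ' → PathWithin p q ℓ'
  within-weaken (c , C , c≤ℓ) ℓ≤ℓ' = c , C , ≤-trans c≤ℓ ℓ≤ℓ'

  within-sym : PathWithin p q ℓ → PathWithin q p ℓ
  within-sym (c , C , c≤ℓ) = c , cand-sym C , c≤ℓ

  cand-trans : Cand G p q ℓ → Cand G q w ℓ' → PathWithin p w (ℓ + ℓ')
  cand-trans (via {oa = oa} {ob = ob} {k = k} pa qb w₁) (via {oa = ob'} {ob = oc} {k = m} qb' wc w₂) =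
    let j , wj , j≤ = anchor-junction qb qb'
    in _ , via pa wc (w₁ ++ʷ (wj ++ʷ w₂)) , junction-bound {oa} {ob} {ob'} {oc} k m j≤
  cand-trans (via {oa = oa} {ob = ob} {k = k} pa qb w₁) (same {t = t} {t' = t'}) =
    let o' , wb , o'≤ = anchor-slide same-edge qb
    in _ , via pa wb w₁ , subst (oa + ℕ→ℚ k + o' ≤_) (sym (+-assoc (oa + ℕ→ℚ k) ob ∣ t - t' ∣))
                             (+-monoʳ-≤ (oa + ℕ→ℚ k) o'≤)
  cand-trans (same {t = t} {t' = t'}) (via {oa = ob} {ob = oc} {k = m} qb wc w₂) =
    let _ , pb , o'≤ = anchor-slide (sameEdge-sym same-edge) qb
    in _ , via pb wc w₂ , slide-bound {ob} {s = ∣ t - t' ∣} {ℕ→ℚ m} {oc} o'≤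
  cand-trans (same {t = t} {t' = t'}) (same {t' = t''}) = _ , same , ∣p-r∣≤∣p-q∣+∣q-r∣ t t' t''

  within-trans : PathWithin p q ℓ → PathWithin q w ℓ' → PathWithin p w (ℓ + ℓ')
  within-trans (_ , C , c≤ℓ) (_ , C' , c'≤ℓ') =
    let d , D , d≤ = cand-trans C C' in d , D , ≤-trans d≤ (+-mono-≤ c≤ℓ c'≤ℓ')

  LowerBound : Point G → Point G → ℚ → Set
  LowerBound p q ℓ = ∀ c → Cand G p q c → ℓ ≤ c

  lowerBound-within : LowerBound p q ℓ → PathWithin p q ℓ' → ℓ ≤ ℓ'
  lowerBound-within ℓ≤ (c , C , c≤ℓ') = ≤-trans (ℓ≤ c C) c≤ℓ'

  dist⇒within : IsDist G p q ℓ → PathWithin p q ℓ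
  dist⇒within (C , _) = cand⇒within C

  dist-≤ : IsDist G p q ℓ → PathWithin p q ℓ' → ℓ ≤ ℓ'
  dist-≤ (_ , ℓ≤) = lowerBound-within ℓ≤

  dist-intro : PathWithin p q ℓ → LowerBound p q ℓ → IsDist G p q ℓ
  dist-intro (c , C , c≤ℓ) ℓ≤ = subst (Cand G _ _) (≤-antisym c≤ℓ (ℓ≤ c C)) C , ℓ≤

  dist-sym : IsDist G p q ℓ → IsDist G q p ℓ
  dist-sym (C , ℓ≤) = cand-sym C , λ c C' → ℓ≤ c (cand-sym C')

  dist-unique : IsDist G p q ℓ → IsDist G p q ℓ' → ℓ ≡ ℓ'
  dist-unique d d' = ≤-antisym (dist-≤ d (dist⇒within d')) (dist-≤ d' (dist⇒within d))

  dist-triangle : IsDist G p q ℓ → IsDist G p w ℓ' → IsDist G q w o → ℓ ≤ ℓ' + o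
  dist-triangle dpq dpw dqw = dist-≤ dpq (within-trans (dist⇒within dpw) (within-sym (dist⇒within dqw)))

  ≈-refl : _≈_ G p p
  ≈-refl {vtx a} = via anc-vtx anc-vtx here , λ c C → cand-nonneg C
  ≈-refl {mid _ _ _ _ t _ _} = subst (Cand G _ _) (cong ∣_∣ (+-inverseʳ t)) same , λ c C → cand-nonneg C

  ≈-sym : _≈_ G p q → _≈_ G q p
  ≈-sym = dist-sym

  within-resp-≈ : _≈_ G p' p → _≈_ G q q' → PathWithin p q ℓ → PathWithin p' q' ℓ
  within-resp-≈ {ℓ = ℓ} p'≈p q≈q' W = within-weaken
    (within-trans (within-trans (dist⇒within p'≈p) W) (dist⇒within q≈q')) (≤-reflexive (0+p+0≡p ℓ))

  dist-resp-≈ : _≈_ G p p' → _≈_ G q q' → IsDist G p q ℓ → IsDist G p' q' ℓ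
  dist-resp-≈ p≈p' q≈q' d = dist-intro (within-resp-≈ (≈-sym p≈p') q≈q' (dist⇒within d))
    λ c C → dist-≤ d (within-resp-≈ p≈p' (≈-sym q≈q') (cand⇒within C))

  ≈-trans : _≈_ G p q → _≈_ G q w → _≈_ G p w
  ≈-trans p≈q q≈w = dist-resp-≈ ≈-refl q≈w p≈q

  vdist-lowerBound : VDist G a b k → LowerBound (vtx a) (vtx b) (ℕ→ℚ k)
  vdist-lowerBound {k = k} (_ , shortest) _ (via {k = m} anc-vtx anc-vtx w) =
    subst (ℕ→ℚ k ≤_) (sym (0+p+0≡p (ℕ→ℚ m))) (ℕ→ℚ-mono-≤ (shortest m w))

  vdist⇒dist : VDist G a b k → IsDist G (vtx a) (vtx b) (ℕ→ℚ k)
  vdist⇒dist {k = k} d@(w , _) =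
    dist-intro (within-weaken (cand⇒within (via anc-vtx anc-vtx w)) (≤-reflexive (0+p+0≡p (ℕ→ℚ k))))
               (vdist-lowerBound d)

  adj⇒vdist : Adj a b → VDist G a b 1
  adj⇒vdist e = step e here , λ where
    zero here → contradiction e irrefl
    (suc _) _ → ℕ.s≤s ℕ.z≤n

  -- Geodesics

  geodesic-by-bounds : (L : ℚ) → 0ℚ ≤ L → (f : ℚ → Point G) → _≈_ G (f 0ℚ) p → _≈_ G (f L) q →
    (∀ s t → 0ℚ ≤ s → s ≤ t → t ≤ L → PathWithin (f s) (f t) (t - s)) →
    LowerBound p q L → Geodesic G p q
  geodesic-by-bounds L 0≤L f f0≈p fL≈q within L≤ = record
    { len = L ; len≥0 = 0≤L ; γ = f ; start = f0≈p ; end = fL≈q ; isom = isometric }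
    where
    -- A shortcut between f s and f t would give a path from p to q shorter than L.
    ordered : ∀ s t → 0ℚ ≤ s → s ≤ t → t ≤ L → IsDist G (f s) (f t) (t - s)
    ordered s t 0≤s s≤t t≤L = dist-intro (within s t 0≤s s≤t t≤L) λ c C → ≤-via-gap
      (lowerBound-within L≤ (within-resp-≈ (≈-sym f0≈p) fL≈q
        (within-trans (within-trans (within 0ℚ s ≤-refl 0≤s (≤-trans s≤t t≤L)) (cand⇒within C))
                      (within t L (≤-trans 0≤s s≤t) t≤L ≤-refl))))
      (solve 4 (λ s t c L → (s :- con 0ℚ) :+ c :+ (L :- t) :- L := c :- (t :- s)) refl s t c L)
    isometric : ∀ s t → 0ℚ ≤ s → s ≤ L → 0ℚ ≤ t → t ≤ L → IsDist G (f s) (f t) ∣ s - t ∣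
    isometric s t 0≤s s≤L 0≤t t≤L with ≤-total s t
    ... | inj₁ s≤t = subst (IsDist G _ _) (sym (p≤q⇒∣p-q∣≡q-p s≤t)) (ordered s t 0≤s s≤t t≤L)
    ... | inj₂ t≤s = subst (IsDist G _ _) (trans (sym (p≤q⇒∣p-q∣≡q-p t≤s)) (∣p-q∣≡∣q-p∣ t s))
                       (dist-sym (ordered t s 0≤t t≤s s≤L))

  geodesic-within : (g : Geodesic G p q) → ∀ s t → 0ℚ ≤ s → s ≤ t → t ≤ len g →
                    PathWithin (γ g s) (γ g t) (t - s)
  geodesic-within g s t 0≤s s≤t t≤L = within-weaken
    (dist⇒within (isom g s t 0≤s (≤-trans s≤t t≤L) (≤-trans 0≤s s≤t) t≤L)) (≤-reflexive (p≤q⇒∣p-q∣≡q-p s≤t))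

  geodesic-dist : (g : Geodesic G p q) → IsDist G p q (len g)
  geodesic-dist g = dist-resp-≈ (start g) (end g)
    (subst (IsDist G _ _) (trans (p≤q⇒∣p-q∣≡q-p (len≥0 g)) (+-identityʳ (len g)))
      (isom g 0ℚ (len g) ≤-refl (len≥0 g) (len≥0 g) ≤-refl))

  geodesic-vdist-len : VDist G a b k → (g : Geodesic G (vtx a) (vtx b)) → len g ≡ ℕ→ℚ k
  geodesic-vdist-len d g = dist-unique (geodesic-dist g) (vdist⇒dist d)

  reverse-geodesic : Geodesic G p q → Geodesic G q p
  reverse-geodesic {p} {q} g = geodesic-by-bounds L (len≥0 g) (revAt G g)
    (subst (λ s → _≈_ G (γ g s) q) (sym (+-identityʳ L)) (end g))
    (subst (λ s → _≈_ G (γ g s) p) (sym (+-inverseʳ L)) (start g))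
    within
    (λ c C → dist-≤ (geodesic-dist g) (cand⇒within (cand-sym C)))
    where
    L : ℚ
    L = len g
    within : ∀ s t → 0ℚ ≤ s → s ≤ t → t ≤ L → PathWithin (revAt G g s) (revAt G g t) (t - s)
    within s t 0≤s s≤t t≤L = subst (PathWithin _ _) (solve 3 (λ L s t → (L :- s) :- (L :- t) := t :- s) refl L s t)
      (within-sym (geodesic-within g (L - t) (L - s) (p≤q⇒0≤q-p t≤L)
        (≤-via-gap s≤t (solve 3 (λ L s t → t :- s := (L :- s) :- (L :- t)) refl L s t))
        (≤-via-gap 0≤s (solve 2 (λ L s → s :- con 0ℚ := L :- (L :- s)) refl L s))))

  splice : ℚ → (ℚ → Point G) → (ℚ → Point G) → ℚ → Point G
  splice L f h s with s ≤? L
  ... | yes _ = f s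
  ... | no _  = h (s - L)

  concat-geodesic : (g₁ : Geodesic G p q) (g₂ : Geodesic G q w) →
                    LowerBound p w (len g₁ + len g₂) → Geodesic G p w
  concat-geodesic {p} {q} {w} g₁ g₂ L≤ =
    geodesic-by-bounds (L₁ + L₂) (+-mono-≤ (len≥0 g₁) (len≥0 g₂)) f f-start f-end within L≤
    where
    L₁ L₂ : ℚ
    L₁ = len g₁
    L₂ = len g₂
    f : ℚ → Point G
    f = splice L₁ (γ g₁) (γ g₂)
    junction : _≈_ G (γ g₁ L₁) (γ g₂ 0ℚ)
    junction = ≈-trans (end g₁) (≈-sym (start g₂))
    0≤s-L₁ : ∀ {s} → ¬ s ≤ L₁ → 0ℚ ≤ s - L₁
    0≤s-L₁ s≰L₁ = p≤q⇒0≤q-p (<⇒≤ (≰⇒> s≰L₁))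
    s-L₁≤L₂ : ∀ {s} → s ≤ L₁ + L₂ → s - L₁ ≤ L₂
    s-L₁≤L₂ {s} s≤L = ≤-via-gap s≤L (solve 3 (λ a b s → (a :+ b) :- s := b :- (s :- a)) refl L₁ L₂ s)
    f-start : _≈_ G (f 0ℚ) p
    f-start with 0ℚ ≤? L₁
    ... | yes _   = start g₁
    ... | no 0≰L₁ = contradiction (len≥0 g₁) 0≰L₁
    f-end : _≈_ G (f (L₁ + L₂)) w
    f-end with (L₁ + L₂) ≤? L₁
    ... | no _ = subst (λ s → _≈_ G (γ g₂ s) w) (sym (solve 2 (λ a b → (a :+ b) :- a := b) refl L₁ L₂)) (end g₂)
    ... | yes L≤L₁ = ≈-trans (subst (λ s → _≈_ G (γ g₁ s) (γ g₂ 0ℚ)) (sym L₁+L₂≡L₁) junction)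
                             (subst (λ s → _≈_ G (γ g₂ s) w) L₂≡0 (end g₂))
      where
      L₂≡0 : L₂ ≡ 0ℚ
      L₂≡0 = ≤-antisym (≤-via-gap L≤L₁ (solve 2 (λ a b → a :- (a :+ b) := con 0ℚ :- b) refl L₁ L₂)) (len≥0 g₂)
      L₁+L₂≡L₁ : L₁ + L₂ ≡ L₁
      L₁+L₂≡L₁ = trans (cong (λ x → L₁ + x) L₂≡0) (+-identityʳ L₁)
    within : ∀ s t → 0ℚ ≤ s → s ≤ t → t ≤ L₁ + L₂ → PathWithin (f s) (f t) (t - s)
    within s t 0≤s s≤t t≤L with s ≤? L₁ | t ≤? L₁
    ... | yes s≤L₁ | yes t≤L₁ = geodesic-within g₁ s t 0≤s s≤t t≤L₁
    ... | no s≰L₁  | yes t≤L₁ = contradiction (≤-trans s≤t t≤L₁) s≰L₁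
    ... | yes s≤L₁ | no t≰L₁  = within-weaken
      (within-trans (geodesic-within g₁ s L₁ 0≤s s≤L₁ ≤-refl)
                    (within-resp-≈ junction ≈-refl
                      (geodesic-within g₂ 0ℚ (t - L₁) ≤-refl (0≤s-L₁ t≰L₁) (s-L₁≤L₂ t≤L))))
      (≤-reflexive (solve 3 (λ s t a → (a :- s) :+ ((t :- a) :- con 0ℚ) := t :- s) refl s t L₁))
    ... | no s≰L₁  | no t≰L₁  =
      subst (PathWithin _ _) (solve 3 (λ s t a → (t :- a) :- (s :- a) := t :- s) refl s t L₁)
        (geodesic-within g₂ (s - L₁) (t - L₁) (0≤s-L₁ s≰L₁) (+-monoˡ-≤ (- L₁) s≤t) (s-L₁≤L₂ t≤L))

  data EdgePosition (s : ℚ) : Set where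
    at-start : s ≤ 0ℚ → EdgePosition s
    inside   : 0ℚ < s → s < 1ℚ → EdgePosition s
    at-end   : 1ℚ ≤ s → EdgePosition s

  edgePosition : ∀ s → EdgePosition s
  edgePosition s with s ≤? 0ℚ | s <? 1ℚ
  ... | yes s≤0 | _       = at-start s≤0
  ... | no s≰0  | yes s<1 = inside (≰⇒> s≰0) s<1
  ... | no _    | no s≮1  = at-end (≮⇒≥ s≮1)

  module _ {u v : Fin n} (u<v : toℕ u ℕ.< toℕ v) (e : Adj u v) where

    edge-point : ∀ {s} → EdgePosition s → Point G
    edge-point (at-start _)       = vtx u
    edge-point (inside 0<s s<1)   = mid u v u<v e _ 0<s s<1
    edge-point (at-end _)         = vtx v

    edge-within : ∀ {s t} (ps : EdgePosition s) (pt : EdgePosition t) → s ≤ t →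
                  PathWithin (edge-point ps) (edge-point pt) (t - s)
    edge-within (at-start _) (at-start _) s≤t =
      within-weaken (cand⇒within (via anc-vtx anc-vtx here)) (p≤q⇒0≤q-p s≤t)
    edge-within {s} {t} (at-start s≤0) (inside _ _) _ =
      within-weaken (cand⇒within (via anc-vtx anc-l here))
        (≤-via-gap s≤0 (solve 2 (λ s t → con 0ℚ :- s := (t :- s) :- (con 0ℚ :+ t)) refl s t))
    edge-within (at-start s≤0) (at-end 1≤t) _ =
      within-weaken (cand⇒within (via anc-vtx anc-vtx (step e here))) (+-mono-≤ 1≤t (neg-antimono-≤ s≤0))
    edge-within (inside 0<s _) (at-start t≤0) s≤t = contradiction (≤-trans s≤t t≤0) (<⇒≱ 0<s)
    edge-within (inside _ _) (inside _ _) s≤t = within-weaken (cand⇒within same) (≤-reflexive (p≤q⇒∣p-q∣≡q-p s≤t))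
    edge-within {s} {t} (inside _ _) (at-end 1≤t) _ =
      within-weaken (cand⇒within (via anc-r anc-vtx here))
        (≤-via-gap 1≤t (solve 2 (λ s t → t :- con 1ℚ := (t :- s) :- ((con 1ℚ :- s) :+ con 0ℚ :+ con 0ℚ)) refl s t))
    edge-within (at-end 1≤s) (at-start t≤0) s≤t = contradiction (≤-trans 1≤s (≤-trans s≤t t≤0)) (<⇒≱ 0<1)
    edge-within (at-end 1≤s) (inside _ t<1) s≤t = contradiction (≤-trans 1≤s s≤t) (<⇒≱ t<1)
    edge-within (at-end _) (at-end _) s≤t =
      within-weaken (cand⇒within (via anc-vtx anc-vtx here)) (p≤q⇒0≤q-p s≤t)

    ordered-edge-geodesic : Geodesic G (vtx u) (vtx v)
    ordered-edge-geodesic = geodesic-by-bounds 1ℚ (<⇒≤ 0<1) (λ s → edge-point (edgePosition s)) ≈-refl ≈-refl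
      (λ s t _ s≤t _ → edge-within (edgePosition s) (edgePosition t) s≤t)
      (vdist-lowerBound (adj⇒vdist e))

  -- Interior points are stored from the endpoint of smaller index, hence the reversal.
  edge-geodesic : Adj a b → Geodesic G (vtx a) (vtx b)
  edge-geodesic {a} {b} e with toℕ a ℕ.<? toℕ b
  ... | yes a<b = ordered-edge-geodesic a<b e
  ... | no a≮b  = reverse-geodesic (ordered-edge-geodesic b<a (Adj-sym e))
    where
    b<a : toℕ b ℕ.< toℕ a
    b<a = ℕₚ.≤∧≢⇒< (ℕₚ.≮⇒≥ a≮b) (λ b≡a → irrefl (subst (Adj a) (toℕ-injective b≡a) e))

  constant-geodesic : Geodesic G (vtx a) (vtx a)
  constant-geodesic {a} = geodesic-by-bounds 0ℚ ≤-refl (λ _ → vtx a) ≈-refl ≈-refl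
    (λ s t _ s≤t _ → within-weaken (cand⇒within (via anc-vtx anc-vtx here)) (p≤q⇒0≤q-p s≤t))
    (λ c C → cand-nonneg C)

  shortest-walk-geodesic : (w : Walk G a b k) → (∀ m → Walk G a b m → k ℕ.≤ m) → Geodesic G (vtx a) (vtx b)
  shortest-walk-geodesic here _ = constant-geodesic
  shortest-walk-geodesic {k = suc k} (step e w) shortest =
    concat-geodesic (edge-geodesic e) rest (subst (λ L → LowerBound _ _ L) total (vdist-lowerBound (step e w , shortest)))
    where
    rest-shortest : ∀ m → Walk G _ _ m → k ℕ.≤ m
    rest-shortest m w' = ℕ.s≤s⁻¹ (shortest (suc m) (step e w'))
    rest : Geodesic G (vtx _) (vtx _)
    rest = shortest-walk-geodesic w rest-shortest
    total : ℕ→ℚ (suc k) ≡ len (edge-geodesic e) + len rest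
    total = trans (ℕ→ℚ-+ 1 k) (sym (cong₂ _+_ (geodesic-vdist-len (adj⇒vdist e) (edge-geodesic e))
                                             (geodesic-vdist-len (w , rest-shortest) rest)))

  vdist-geodesic : VDist G a b k → Geodesic G (vtx a) (vtx b)
  vdist-geodesic (w , shortest) = shortest-walk-geodesic w shortest

  -- Existence of distances

  ¬¬-vdist : Connected G → ∀ a b → ¬ ¬ ∃ (VDist G a b)
  ¬¬-vdist conn a b = ¬¬-minimal (proj₂ (conn a b))

  Anchored : Point G → (Fin n → ℚ → ℚ → Set) → ℚ → Set
  Anchored p F ℓ = ∃[ a ] ∃[ o ] Anchor G p a o × F a o ℓ

  ¬¬-least-anchored : ∀ p {F} → (∀ a o → ¬ ¬ Least (F a o)) → ¬ ¬ Least (Anchored p F)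
  ¬¬-least-anchored (vtx a) least =
    least-resp (λ f → a , 0ℚ , anc-vtx , f) (λ { (_ , _ , anc-vtx , f) → f }) <$> least a 0ℚ
  ¬¬-least-anchored p@(mid u v _ _ t _ _) {F} least = do
    least-u ← least u t
    least-v ← least v (1ℚ - t)
    pure (least-resp to from (least-⊎ least-u least-v))
    where
    to : ∀ {ℓ} → F u t ℓ ⊎ F v (1ℚ - t) ℓ → Anchored p F ℓ
    to (inj₁ f) = u , t , anc-l , f
    to (inj₂ f) = v , 1ℚ - t , anc-r , f
    from : ∀ {ℓ} → Anchored p F ℓ → F u t ℓ ⊎ F v (1ℚ - t) ℓ
    from (_ , _ , anc-l , f) = inj₁ f
    from (_ , _ , anc-r , f) = inj₂ f

  WalkLength : Fin n → ℚ → Fin n → ℚ → ℚ → Set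
  WalkLength a oa b ob ℓ = ∃[ k ] Walk G a b k × ℓ ≡ oa + ℕ→ℚ k + ob

  ¬¬-least-walkLength : Connected G → ∀ a oa b ob → ¬ ¬ Least (WalkLength a oa b ob)
  ¬¬-least-walkLength conn a oa b ob = least <$> ¬¬-vdist conn a b
    where
    least : ∃ (VDist G a b) → Least (WalkLength a oa b ob)
    least (k , w , shortest) = oa + ℕ→ℚ k + ob , (k , w , refl) ,
      λ { _ (m , w' , refl) → +-monoˡ-≤ ob (+-monoʳ-≤ oa (ℕ→ℚ-mono-≤ (shortest m w'))) }

  Via : Point G → Point G → ℚ → Set
  Via p q = Anchored p (λ a oa → Anchored q (λ b ob → WalkLength a oa b ob))

  via⇒cand : Via p q ℓ → Cand G p q ℓ
  via⇒cand (_ , _ , pa , _ , _ , qb , _ , w , refl) = via pa qb w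

  sameEdge⇒cand : SameEdge p q ℓ → Cand G p q ℓ
  sameEdge⇒cand same-edge = same

  cand-split : Cand G p q ℓ → Via p q ℓ ⊎ SameEdge p q ℓ
  cand-split (via pa qb w) = inj₁ (_ , _ , pa , _ , _ , qb , _ , w , refl)
  cand-split same          = inj₂ same-edge

  ¬¬-dist : Connected G → ∀ p q → ¬ ¬ ∃ (IsDist G p q)
  ¬¬-dist conn p q = do
    least-via ← ¬¬-least-anchored p λ a oa → ¬¬-least-anchored q λ b ob → ¬¬-least-walkLength conn a oa b ob
    same? ← ¬¬-excluded-middle
    pure (least-cand least-via same?)
    where
    least-cand : Least (Via p q) → Dec (∃ (SameEdge p q)) → Least (Cand G p q)
    least-cand least-via (yes (ℓ , se)) = least-resp [ via⇒cand , sameEdge⇒cand ]′ cand-split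
      (least-⊎ least-via (ℓ , se , λ c se' → ≤-reflexive (sameEdge-unique se se')))
    least-cand least-via (no ¬same) = least-resp via⇒cand
      (λ C → [ id , (λ se → contradiction (_ , se) ¬same) ]′ (cand-split C)) least-via

  -- The midpoint bound

  corner-midpoint-bound : Connected G → ∀ {z f α δ h r} (gw : Geodesic G p (vtx z)) →
    CornerBound G f (γ gw) α δ → 0ℚ ≤ h → h ≤ α → h ≤ len gw → len gw ≤ h + h →
    IsDist G (vtx z) (f h) r → ¬ ¬ (r ≤ h + δ)
  corner-midpoint-bound conn {z} {f} {δ = δ} {h} {r} gw corner 0≤h h≤α h≤L L≤2h dzc = do
    r' , dcw ← ¬¬-dist conn (f h) (γ gw h)
    pure (begin
      r                    ≤⟨ dist-≤ dzc (within-trans z→γh (dist⇒within (dist-sym dcw))) ⟩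
      len gw - h + r'      ≤⟨ +-mono-≤ (p≤q+q⇒p-q≤q L≤2h) (corner h r' 0≤h h≤α dcw) ⟩
      h + δ                ∎)
    where
    open ≤-Reasoning
    z→γh : PathWithin (vtx z) (γ gw h) (len gw - h)
    z→γh = within-sym (within-resp-≈ ≈-refl (end gw) (geodesic-within gw h (len gw) 0≤h h≤L ≤-refl))

  midpoint-bound : Connected G → ∀ {x y z δ h r} → HypBound G δ → (g : Geodesic G (vtx x) (vtx y)) →
    len g ≡ h + h → 0ℚ ≤ h → (gxz : Geodesic G (vtx x) (vtx z)) (gyz : Geodesic G (vtx y) (vtx z)) →
    len gxz ≤ len g → len gyz ≤ len g → IsDist G (vtx z) (γ g h) r → ¬ ¬ (r ≤ h + δ)
  midpoint-bound conn {x} {y} {z} {δ} {h} {r} hyp g L≡2h 0≤h gxz gyz X≤L Y≤L dzc = [ at-x , at-y ]′ (≤-total Y X)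
    where
    X Y : ℚ
    X = len gxz
    Y = len gyz
    insize : InsizeLe G g gyz gxz δ
    insize = hyp (vtx x) (vtx y) (vtx z) g gyz gxz
    2h≤X+Y : h + h ≤ X + Y
    2h≤X+Y = subst (_≤ X + Y) L≡2h (dist-triangle (geodesic-dist g) (geodesic-dist gxz) (geodesic-dist gyz))
    at-x : Y ≤ X → ¬ ¬ (r ≤ h + δ)
    at-x Y≤X = corner-midpoint-bound conn gxz (proj₁ insize) 0≤h
      (subst (λ L → h ≤ ½ * (L + Y + X) - Y) (sym L≡2h) (h≤½[h+h+a+b]-c h (+-monoʳ-≤ Y Y≤X)))
      (p+p≤q+r⇒r≤q⇒p≤q 2h≤X+Y Y≤X) (subst (X ≤_) L≡2h X≤L) dzc
    at-y : X ≤ Y → ¬ ¬ (r ≤ h + δ)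
    at-y X≤Y = corner-midpoint-bound conn gyz (proj₁ (proj₂ insize)) 0≤h
      (subst (λ L → h ≤ ½ * (L + Y + X) - X) (sym L≡2h) (h≤½[h+h+a+b]-c h (+-monoˡ-≤ X X≤Y)))
      (p+p≤q+r⇒r≤q⇒p≤q (subst (h + h ≤_) (+-comm X Y) 2h≤X+Y) X≤Y) (subst (Y ≤_) L≡2h Y≤L)
      (subst (λ s → IsDist G (vtx z) (γ g s) r) h≡L-h dzc)
      where
      h≡L-h : h ≡ len g - h
      h≡L-h = sym (trans (cong (_- h) L≡2h) (solve 1 (λ h → h :+ h :- h := h) refl h))

mainTheorem6 : (G : Graph) → Connected G →
    (δ : ℚ) → IsHyperbolicityConstant G δ →
    (x y : Fin (Graph.n G)) → LocallyDiametrical G x y →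
    (D : ℕ) → VDist G x y D →
    (g : Geodesic G (vtx x) (vtx y)) →
    (z : Fin (Graph.n G)) → (r : ℚ) →
    IsDist G (vtx z) (γ g (+ D / 2)) r →
    r ≤ (+ D / 2) + δ
mainTheorem6 G conn δ (hyp , _) x y (D' , dxy' , ecc-x , ecc-y) D dxy g z r dzc =
  decidable-stable (r ≤? + D / 2 + δ) (do
    kx , dxz ← ¬¬-vdist conn x z
    ky , dyz ← ¬¬-vdist conn y z
    midpoint-bound conn hyp g len-g (half-nonneg D) (vdist-geodesic dxz) (vdist-geodesic dyz)
      (no-longer-than-g dxz (ecc-x z kx dxz)) (no-longer-than-g dyz (ecc-y z ky dyz)) dzc)
  where
  open PathMetric G
  len-g : len g ≡ + D / 2 + + D / 2
  len-g = trans (geodesic-vdist-len dxy g) (sym (half+half D))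
  no-longer-than-g : ∀ {a k} (d : VDist G a z k) → k ℕ.≤ D' → len (vdist-geodesic d) ≤ len g
  no-longer-than-g d k≤D' = subst₂ _≤_ (sym (geodesic-vdist-len d (vdist-geodesic d))) (sym (geodesic-vdist-len dxy g))
    (ℕ→ℚ-mono-≤ (ℕₚ.≤-trans k≤D' (proj₂ dxy' D (proj₁ dxy))))
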